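{- Let $\gamma$ be a positive integer and let $\delta,\mu$ be reals with $1>\delta>\gamma^{ -1}+\mu\ge 2\gamma^{ -1}>0$, and let $\alpha'>0$. Let $G$ be a graph, let $O$ be a $(\gamma,\alpha')$-orientation of $G$, and let $H$ be a $(\delta,\mu)$-refinement of $G$ with respect to $O$. Then there exists a $(\gamma,\alpha')$-orientation $O'$ of $G$ and a $(\delta,\mu)$-refinement $H'$ of $G$ with respect to $O'$ such that $H'$ is a forest.
   Context: A fractional $\alpha'$-bounded out-degree orientation of a graph $G$ assigns to each edge $e=uv$ two numbers $X_e^u,X_e^v\in[0,1]$ with $X_e^u+X_e^v=1$, such that for every vertex $v$ the load $s(v)=\sum_{e\ni v}X_e^v$ is at most $\alpha'$. If moreover all $X_e^u,X_e^v$ lie in $\gamma^{ -1}\mathbb{Z}$, it is called a $(\gamma,\alpha')$-orientation. Given such an orientation $O$, a graph $H$ is a $(\delta,\mu)$-refinement of $G$ with respect to $O$ if: (1) $V(H)=V(G)$ and $E(H)\subseteq E(G)$; (2) every edge $e=uv\in E(G)$ with $X_e^u,X_e^v\in(\delta,1-\delta)$ belongs to $H$; (3) every edge $e=uv\in E(H)$ satisfies $X_e^u,X_e^v\in[\delta-\mu,1-\delta+\mu]$.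
   Formalization: The parameters δ, μ and α' are taken in ℚ rather than ranging over the reals. -}

module Defs where

open import Data.Nat using (ℕ; zero; suc; NonZero)
open import Data.Integer using (ℤ; +_)
open import Data.Rational using (ℚ; 0ℚ; 1ℚ; _+_; _-_; _≤_; _<_; _/_)
open import Data.Fin using (Fin; zero; suc; inject₁; fromℕ)
open import Data.Bool using (Bool; true; false; if_then_else_)
open import Data.Product using (Σ; ∃; _×_)
open import Relation.Binary.PropositionalEquality using (_≡_)
open import Relation.Nullary using (¬_)
open import Function.Definitions using (Injective)

record Graph (n : ℕ) : Set where
  field
    adj    : Fin n → Fin n → Bool
    sym    : ∀ u v → adj u v ≡ adj v u
    irrefl : ∀ v → adj v v ≡ false
open Graph public

sumFin : (n : ℕ) → (Fin n → ℚ) → ℚ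
sumFin zero    f = 0ℚ
sumFin (suc n) f = f zero + sumFin n (λ i → f (suc i))

-- An orientation assigns, for the edge e = uv, the number X u v = X_e^u
-- (the share of e at endpoint u). Values at non-edges are irrelevant.
Orientation : ℕ → Set
Orientation n = Fin n → Fin n → ℚ

load : {n : ℕ} → Graph n → Orientation n → Fin n → ℚ
load {n} G X v = sumFin n (λ u → if adj G v u then X v u else 0ℚ)

IsFracOrientation : {n : ℕ} → ℚ → Graph n → Orientation n → Set
IsFracOrientation α G X =
  (∀ u v → adj G u v ≡ true →
     (0ℚ ≤ X u v) × (X u v ≤ 1ℚ) × (X u v + X v u ≡ 1ℚ))
  × (∀ v → load G X v ≤ α)

InGrid : (γ : ℕ) .{{_ : NonZero γ}} → ℚ → Set
InGrid γ q = ∃ λ (k : ℤ) → q ≡ k / γ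

IsGammaOrientation : {n : ℕ} (γ : ℕ) .{{_ : NonZero γ}} → ℚ →
                     Graph n → Orientation n → Set
IsGammaOrientation γ α G X =
  IsFracOrientation α G X × (∀ u v → adj G u v ≡ true → InGrid γ (X u v))

IsRefinement : {n : ℕ} → ℚ → ℚ → Graph n → Orientation n → Graph n → Set
IsRefinement δ μ G X H =
  (∀ u v → adj H u v ≡ true → adj G u v ≡ true)
  × (∀ u v → adj G u v ≡ true →
       δ < X u v → X u v < 1ℚ - δ →
       δ < X v u → X v u < 1ℚ - δ →
       adj H u v ≡ true)
  × (∀ u v → adj H u v ≡ true →
       (δ - μ ≤ X u v) × (X u v ≤ (1ℚ - δ) + μ) ×
       (δ - μ ≤ X v u) × (X v u ≤ (1ℚ - δ) + μ))

HasCycle : {n : ℕ} → Graph n → Set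
HasCycle {n} H =
  Σ ℕ λ k → Σ (Fin (suc (suc (suc k))) → Fin n) λ f →
    Injective _≡_ _≡_ f
    × (∀ (i : Fin (suc (suc k))) → adj H (f (inject₁ i)) (f (suc i)) ≡ true)
    × (adj H (f (fromℕ (suc (suc k)))) (f zero) ≡ true)

IsForest : {n : ℕ} → Graph n → Set
IsForest H = ¬ HasCycle H

-- If the balanced graph of an orientation (the edges both of whose shares lie strictly
-- between δ and 1 − δ) contains a cycle, push 1/γ around it: each cycle vertex gains 1/γ on
-- its outgoing arc and loses 1/γ on its incoming one. Loads, the grid γ⁻¹ℤ and the identity
-- X_e^u + X_e^v = 1 are preserved, shares stay in [0, 1] because 1/γ < δ, and edges off the
-- cycle are untouched, so the balanced graph can only shrink. After γ pushes the share on the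
-- first arc would have grown by 1, so some cycle edge leaves the balanced graph before that;
-- induction on its number of edges yields an orientation whose balanced graph is a forest,
-- and the balanced graph is always a (δ, μ)-refinement.
module Submission where

open import Defs hiding (sym)
open import Algebra.Bundles using (Ring)
open import Data.Bool using (Bool; true; false; _∧_; if_then_else_)
import Data.Bool.Properties as BoolP
open import Data.Fin using (Fin; zero; suc; inject₁; fromℕ; fromℕ<; toℕ; punchIn; finToFun; funToFin)
open import Data.Fin.Properties
  using (any?; all?; ¬∀⟶∃¬; punchInᵢ≢i; suc-injective; toℕ-fromℕ<; finToFun-funToFin; injective⇒≤)
  renaming (_≟_ to _≟ᶠ_)
open import Data.Integer as ℤ using (ℤ; +_)
import Data.Integer.Properties as ℤP
import Data.Integer.Solver as ℤSolver
open import Data.Nat as ℕ using (ℕ; NonZero)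
open import Data.Nat.Induction using (<-wellFounded)
import Data.Nat.Properties as ℕP
open import Data.Product using (Σ; ∃; _×_; _,_; proj₁; proj₂)
open import Data.Rational using (ℚ; 0ℚ; 1ℚ; _+_; _-_; -_; _*_; _<_; _≤_; _/_; _<?_; toℚᵘ)
open import Data.Rational.Properties as ℚP
  using (+-identityʳ; *-identityʳ; *-identityˡ; *-zeroˡ; *-zeroʳ; neg-distrib-+)
open import Data.Rational.Solver using (module +-*-Solver)
import Data.Rational.Unnormalised as ℚᵘ
import Data.Rational.Unnormalised.Properties as ℚᵘP
open import Data.Sum using (_⊎_; inj₁; inj₂)
open import Function using (_∘_)
open import Function.Definitions using (Injective)
open import Induction.WellFounded using (Acc; acc)
open import Relation.Binary.PropositionalEquality
open import Relation.Nullary using (¬_; Dec; yes; no; does; contradiction)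
open import Relation.Nullary.Decidable using (_×-dec_; _→-dec_; dec-true)

import Algebra.Properties.Monoid.Sum ℕP.+-0-monoid as ℕ∑
open import Algebra.Properties.Semiring.Sum (Ring.semiring ℚP.+-*-ring)
  using (sum; sum-syntax; sum-cong-≗; sum-replicate-zero; sum-remove; ∑-distrib-+; ∑-comm;
         sum-init-last; *-distribˡ-sum; *-distribʳ-sum)

open +-*-Solver

sumFin≡∑ : ∀ n (f : Fin n → ℚ) → sumFin n f ≡ ∑[ i < n ] f i
sumFin≡∑ ℕ.zero    f = refl
sumFin≡∑ (ℕ.suc n) f = cong (_+_ (f zero)) (sumFin≡∑ n (f ∘ suc))

∑-zero : ∀ {n} {f : Fin n → ℚ} → (∀ i → f i ≡ 0ℚ) → ∑[ i < n ] f i ≡ 0ℚ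
∑-zero {n} f≡0 = trans (sum-cong-≗ f≡0) (sum-replicate-zero n)

∑-single : ∀ {n} (f : Fin n → ℚ) i₀ → (∀ i → i ≢ i₀ → f i ≡ 0ℚ) → ∑[ i < n ] f i ≡ f i₀
∑-single {ℕ.zero}  f ()
∑-single {ℕ.suc n} f i₀ f≡0 = begin
  sum f                                ≡⟨ sum-remove {i = i₀} f ⟩
  f i₀ + ∑[ j < n ] f (punchIn i₀ j)   ≡⟨ cong (_+_ (f i₀)) (∑-zero (λ j → f≡0 _ (punchInᵢ≢i i₀ j))) ⟩
  f i₀ + 0ℚ                            ≡⟨ +-identityʳ (f i₀) ⟩
  f i₀                                 ∎
  where open ≡-Reasoning

∑-neg : ∀ {n} (f : Fin n → ℚ) → ∑[ i < n ] (- f i) ≡ - (∑[ i < n ] f i)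
∑-neg {ℕ.zero}  f = refl
∑-neg {ℕ.suc n} f = trans (cong (_+_ (- f zero)) (∑-neg (f ∘ suc))) (sym (neg-distrib-+ (f zero) _))

∑-distrib-- : ∀ {n} (f g : Fin n → ℚ) → ∑[ i < n ] (f i - g i) ≡ ∑[ i < n ] f i - ∑[ i < n ] g i
∑-distrib-- f g = trans (∑-distrib-+ f (λ i → - g i)) (cong (_+_ (sum f)) (∑-neg g))

kronecker : ∀ {n} → Fin n → Fin n → ℚ
kronecker a u = if does (a ≟ᶠ u) then 1ℚ else 0ℚ

kronecker-refl : ∀ {n} (a : Fin n) → kronecker a a ≡ 1ℚ
kronecker-refl a with a ≟ᶠ a
... | yes _   = refl
... | no a≢a = contradiction refl a≢a

kronecker-≢ : ∀ {n} {a u : Fin n} → a ≢ u → kronecker a u ≡ 0ℚ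
kronecker-≢ {a = a} {u} a≢u with a ≟ᶠ u
... | yes a≡u = contradiction a≡u a≢u
... | no _    = refl

∑-kronecker : ∀ {n} (a : Fin n) → ∑[ u < n ] kronecker a u ≡ 1ℚ
∑-kronecker a = trans (∑-single (kronecker a) a (λ u u≢a → kronecker-≢ (u≢a ∘ sym))) (kronecker-refl a)

arcIndicator : ∀ {n} → Fin n → Fin n → Fin n → Fin n → ℚ
arcIndicator a b u v = kronecker a u * kronecker b v

arcIndicator-≢ : ∀ {n} (a b u v : Fin n) → ¬ (a ≡ u × b ≡ v) → arcIndicator a b u v ≡ 0ℚ
arcIndicator-≢ a b u v ≢ with a ≟ᶠ u
... | no _    = *-zeroˡ (kronecker b v)
... | yes a≡u = trans (cong (_*_ 1ℚ) (kronecker-≢ (λ b≡v → ≢ (a≡u , b≡v)))) (*-zeroʳ 1ℚ)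

arcFlow : ∀ {n} → Fin n → Fin n → Fin n → Fin n → ℚ
arcFlow a b u v = arcIndicator a b u v - arcIndicator a b v u

arcFlow-skew : ∀ {n} (a b u v : Fin n) → arcFlow a b v u ≡ - arcFlow a b u v
arcFlow-skew a b u v =
  solve 2 (λ x y → y :- x := :- (x :- y)) refl (arcIndicator a b u v) (arcIndicator a b v u)

arcFlow-along : ∀ {n} {a b : Fin n} → a ≢ b → arcFlow a b a b ≡ 1ℚ
arcFlow-along {a = a} {b} a≢b =
  cong₂ _-_ (cong₂ _*_ (kronecker-refl a) (kronecker-refl b)) (arcIndicator-≢ a b b a (a≢b ∘ proj₁))

arcFlow-elsewhere : ∀ {n} {a b u v : Fin n} → ¬ (a ≡ u × b ≡ v) → ¬ (a ≡ v × b ≡ u) → arcFlow a b u v ≡ 0ℚ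
arcFlow-elsewhere {a = a} {b} {u} {v} ≢uv ≢vu = cong₂ _-_ (arcIndicator-≢ a b u v ≢uv) (arcIndicator-≢ a b v u ≢vu)

∑-arcFlow : ∀ {n} (a b v : Fin n) → ∑[ u < n ] arcFlow a b v u ≡ kronecker a v - kronecker b v
∑-arcFlow {n} a b v = begin
  ∑[ u < n ] (kronecker a v * kronecker b u - kronecker a u * kronecker b v)
    ≡⟨ ∑-distrib-- (λ u → kronecker a v * kronecker b u) (λ u → kronecker a u * kronecker b v) ⟩
  ∑[ u < n ] (kronecker a v * kronecker b u) - ∑[ u < n ] (kronecker a u * kronecker b v)
    ≡⟨ cong₂ _-_ (*-distribˡ-sum (kronecker a v) (kronecker b)) (*-distribʳ-sum (kronecker b v) (kronecker a)) ⟨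
  kronecker a v * sum (kronecker b) - sum (kronecker a) * kronecker b v
    ≡⟨ cong₂ (λ x y → kronecker a v * x - y * kronecker b v) (∑-kronecker b) (∑-kronecker a) ⟩
  kronecker a v * 1ℚ - 1ℚ * kronecker b v
    ≡⟨ cong₂ _-_ (*-identityʳ (kronecker a v)) (*-identityˡ (kronecker b v)) ⟩
  kronecker a v - kronecker b v ∎
  where open ≡-Reasoning

-- The i-th arc of a cycle f : Fin (suc m) → Fin n runs from f (cyclePred i) to f i;
-- arc 0 is the closing edge from f (fromℕ m) to f 0.
cyclePred : ∀ {m} → Fin (ℕ.suc m) → Fin (ℕ.suc m)
cyclePred {m} zero    = fromℕ m
cyclePred     (suc i) = inject₁ i

inject₁≢suc : ∀ {m} (i : Fin m) → inject₁ i ≢ suc i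
inject₁≢suc zero    ()
inject₁≢suc (suc i) = inject₁≢suc i ∘ suc-injective

inject₁²≢suc² : ∀ {m} (i : Fin m) → inject₁ (inject₁ i) ≢ suc (suc i)
inject₁²≢suc² zero    ()
inject₁²≢suc² (suc i) = inject₁²≢suc² i ∘ suc-injective

cyclePred-≢ : ∀ {m} (i : Fin (2 ℕ.+ m)) → cyclePred i ≢ i
cyclePred-≢ zero    ()
cyclePred-≢ (suc i) = inject₁≢suc i

cyclePred²-≢ : ∀ {m} (i : Fin (3 ℕ.+ m)) → cyclePred (cyclePred i) ≢ i
cyclePred²-≢ zero          ()
cyclePred²-≢ (suc zero)    ()
cyclePred²-≢ (suc (suc i)) = inject₁²≢suc² i

∑-cyclePred : ∀ {m} (h : Fin (ℕ.suc m) → ℚ) → ∑[ i < ℕ.suc m ] h (cyclePred i) ≡ sum h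
∑-cyclePred h = trans (ℚP.+-comm (h (fromℕ _)) _) (sym (sum-init-last h))

module Circulation {n k} (f : Fin (3 ℕ.+ k) → Fin n) (f-injective : Injective _≡_ _≡_ f) where

  Arc : Fin n → Fin n → Set
  Arc u v = ∃ λ i → f (cyclePred i) ≡ u × f i ≡ v

  arc? : ∀ u v → Dec (Arc u v)
  arc? u v = any? (λ i → (f (cyclePred i) ≟ᶠ u) ×-dec (f i ≟ᶠ v))

  circulation : Fin n → Fin n → ℚ
  circulation u v = ∑[ i < 3 ℕ.+ k ] arcFlow (f (cyclePred i)) (f i) u v

  circulation-skew : ∀ u v → circulation v u ≡ - circulation u v
  circulation-skew u v = trans (sum-cong-≗ (λ i → arcFlow-skew (f (cyclePred i)) (f i) u v))
                               (∑-neg (λ i → arcFlow (f (cyclePred i)) (f i) u v))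

  ∑-circulation : ∀ v → ∑[ u < n ] circulation v u ≡ 0ℚ
  ∑-circulation v = begin
    ∑[ u < n ] ∑[ i < _ ] arcFlow (f (cyclePred i)) (f i) v u
      ≡⟨ ∑-comm (λ u i → arcFlow (f (cyclePred i)) (f i) v u) ⟩
    ∑[ i < _ ] ∑[ u < n ] arcFlow (f (cyclePred i)) (f i) v u
      ≡⟨ sum-cong-≗ (λ i → ∑-arcFlow (f (cyclePred i)) (f i) v) ⟩
    ∑[ i < _ ] (kronecker (f (cyclePred i)) v - kronecker (f i) v)
      ≡⟨ ∑-distrib-- (λ i → kronecker (f (cyclePred i)) v) (λ i → kronecker (f i) v) ⟩
    ∑[ i < _ ] kronecker (f (cyclePred i)) v - ∑[ i < _ ] kronecker (f i) v
      ≡⟨ cong (_- ∑[ i < _ ] kronecker (f i) v) (∑-cyclePred (λ i → kronecker (f i) v)) ⟩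
    ∑[ i < _ ] kronecker (f i) v - ∑[ i < _ ] kronecker (f i) v
      ≡⟨ ℚP.+-inverseʳ (∑[ i < _ ] kronecker (f i) v) ⟩
    0ℚ ∎
    where open ≡-Reasoning

  -- Only arc i₀ carries (u, v): another arc would share its head with arc i₀ (against
  -- injectivity) or be its reverse (against the cycle having at least three vertices).
  circulation-arc : ∀ {u v} → Arc u v → circulation u v ≡ 1ℚ
  circulation-arc (i₀ , refl , refl) =
    trans (∑-single (λ i → arcFlow (f (cyclePred i)) (f i) (f (cyclePred i₀)) (f i₀)) i₀ other-arc)
          (arcFlow-along (cyclePred-≢ i₀ ∘ f-injective))
    where
    other-arc : ∀ i → i ≢ i₀ → arcFlow (f (cyclePred i)) (f i) (f (cyclePred i₀)) (f i₀) ≡ 0ℚ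
    other-arc i i≢i₀ = arcFlow-elsewhere (i≢i₀ ∘ f-injective ∘ proj₂) λ (tail≡ , head≡) →
      cyclePred²-≢ i₀ (trans (cong cyclePred (sym (f-injective head≡))) (f-injective tail≡))

  circulation-elsewhere : ∀ {u v} → ¬ Arc u v → ¬ Arc v u → circulation u v ≡ 0ℚ
  circulation-elsewhere ¬uv ¬vu =
    ∑-zero (λ i → arcFlow-elsewhere (λ (t , h) → ¬uv (i , t , h)) (λ (t , h) → ¬vu (i , t , h)))

  circulation-cases : ∀ u v →
    circulation u v ≡ 0ℚ ⊎ (Arc u v × circulation u v ≡ 1ℚ) ⊎ (Arc v u × circulation u v ≡ - 1ℚ)
  circulation-cases u v with arc? u v | arc? v u
  ... | yes uv | _      = inj₂ (inj₁ (uv , circulation-arc uv))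
  ... | no _   | yes vu = inj₂ (inj₂ (vu , trans (circulation-skew v u) (cong -_ (circulation-arc vu))))
  ... | no ¬uv | no ¬vu = inj₁ (circulation-elsewhere ¬uv ¬vu)

∃-fun? : ∀ {m n} {P : (Fin m → Fin n) → Set} →
         (∀ {f g} → f ≗ g → P f → P g) → (∀ f → Dec (P f)) → Dec (∃ P)
∃-fun? P-resp P? with any? (λ i → P? (finToFun i))
... | yes (i , Pf) = yes (finToFun i , Pf)
... | no ∄ = no λ (f , Pf) → ∄ (funToFin f , P-resp (sym ∘ finToFun-funToFin f) Pf)

injective? : ∀ {m n} (f : Fin m → Fin n) → Dec (Injective _≡_ _≡_ f)
injective? f with all? (λ x → all? (λ y → (f x ≟ᶠ f y) →-dec (x ≟ᶠ y)))
... | yes inj = yes (λ {x} {y} → inj x y)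
... | no ¬inj = no λ inj → ¬inj (λ x y → inj)

IsCycle : ∀ {n} → Graph n → (k : ℕ) → (Fin (3 ℕ.+ k) → Fin n) → Set
IsCycle H k f = Injective _≡_ _≡_ f
  × (∀ (i : Fin (2 ℕ.+ k)) → adj H (f (inject₁ i)) (f (suc i)) ≡ true)
  × (adj H (f (fromℕ (2 ℕ.+ k))) (f zero) ≡ true)

isCycle? : ∀ {n} (H : Graph n) k f → Dec (IsCycle H k f)
isCycle? H k f = injective? f
  ×-dec all? (λ i → adj H (f (inject₁ i)) (f (suc i)) BoolP.≟ true)
  ×-dec (adj H (f (fromℕ (2 ℕ.+ k))) (f zero) BoolP.≟ true)

isCycle-resp : ∀ {n} (H : Graph n) k {f g} → f ≗ g → IsCycle H k f → IsCycle H k g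
isCycle-resp H k f≗g (inj , path , closing) =
  (λ e → inj (trans (f≗g _) (trans e (sym (f≗g _))))) ,
  (λ i → subst₂ (λ x y → adj H x y ≡ true) (f≗g (inject₁ i)) (f≗g (suc i)) (path i)) ,
  subst₂ (λ x y → adj H x y ≡ true) (f≗g _) (f≗g zero) closing

isCycle⇒length< : ∀ {n} (H : Graph n) {k f} → IsCycle H k f → k ℕ.< n
isCycle⇒length< H (inj , _) = ℕP.m+n≤o⇒n≤o 2 (injective⇒≤ inj)

hasCycle? : ∀ {n} (H : Graph n) → Dec (HasCycle H)
hasCycle? {n} H with any? (λ (k : Fin n) → ∃-fun? (isCycle-resp H (toℕ k)) (isCycle? H (toℕ k)))
... | yes (k , cycle) = yes (toℕ k , cycle)
... | no ∄ = no λ (k , f , cycle) →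
  ∄ (fromℕ< (isCycle⇒length< H cycle) ,
     subst (λ k → ∃ (IsCycle H k)) (sym (toℕ-fromℕ< (isCycle⇒length< H cycle))) (f , cycle))

isCycle⇒arcs : ∀ {n} (H : Graph n) {k f} → IsCycle H k f → ∀ i → adj H (f (cyclePred i)) (f i) ≡ true
isCycle⇒arcs H (_ , _    , closing) zero    = closing
isCycle⇒arcs H (_ , path , _)       (suc i) = path i

∑ℕ-mono-≤ : ∀ {m} {f g : Fin m → ℕ} → (∀ i → f i ℕ.≤ g i) → ℕ∑.sum f ℕ.≤ ℕ∑.sum g
∑ℕ-mono-≤ {ℕ.zero}  f≤g = ℕ.z≤n
∑ℕ-mono-≤ {ℕ.suc m} f≤g = ℕP.+-mono-≤ (f≤g zero) (∑ℕ-mono-≤ (f≤g ∘ suc))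

∑ℕ-mono-< : ∀ {m} {f g : Fin m → ℕ} → (∀ i → f i ℕ.≤ g i) → ∀ i₀ → f i₀ ℕ.< g i₀ →
            ℕ∑.sum f ℕ.< ℕ∑.sum g
∑ℕ-mono-< f≤g zero     f<g = ℕP.+-mono-<-≤ f<g (∑ℕ-mono-≤ (f≤g ∘ suc))
∑ℕ-mono-< f≤g (suc i₀) f<g = ℕP.+-mono-≤-< (f≤g zero) (∑ℕ-mono-< (f≤g ∘ suc) i₀ f<g)

_⊆ᴳ_ : ∀ {n} → Graph n → Graph n → Set
H ⊆ᴳ K = ∀ u v → adj H u v ≡ true → adj K u v ≡ true

indicator : Bool → ℕ
indicator b = if b then 1 else 0

indicator-mono : ∀ {b c} → (b ≡ true → c ≡ true) → indicator b ℕ.≤ indicator c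
indicator-mono {false} _   = ℕ.z≤n
indicator-mono {true}  b⇒c rewrite b⇒c refl = ℕP.≤-refl

indicator-< : ∀ {b c} → b ≡ false → c ≡ true → indicator b ℕ.< indicator c
indicator-< refl refl = ℕP.≤-refl

edgeCount : ∀ {n} → Graph n → ℕ
edgeCount H = ℕ∑.sum (λ u → ℕ∑.sum (λ v → indicator (adj H u v)))

edgeCount-mono : ∀ {n} (H K : Graph n) → H ⊆ᴳ K → edgeCount H ℕ.≤ edgeCount K
edgeCount-mono H K H⊆K = ∑ℕ-mono-≤ (λ u → ∑ℕ-mono-≤ (λ v → indicator-mono (H⊆K u v)))

edgeCount-< : ∀ {n} (H K : Graph n) → H ⊆ᴳ K → ∀ u v → adj H u v ≡ false → adj K u v ≡ true →
              edgeCount H ℕ.< edgeCount K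
edgeCount-< H K H⊆K u v uv∉H uv∈K =
  ∑ℕ-mono-< (λ u → ∑ℕ-mono-≤ (λ v → indicator-mono (H⊆K u v))) u
    (∑ℕ-mono-< (λ v → indicator-mono (H⊆K u v)) v (indicator-< uv∉H uv∈K))

+-cancelˡ-≤ : ∀ r {p q} → r + p ≤ r + q → p ≤ q
+-cancelˡ-≤ r {p} {q} r+p≤r+q = begin
  p              ≡⟨ solve 2 (λ r p → p := :- r :+ (r :+ p)) refl r p ⟩
  - r + (r + p)  ≤⟨ ℚP.+-monoʳ-≤ (- r) r+p≤r+q ⟩
  - r + (r + q)  ≡⟨ solve 2 (λ r q → :- r :+ (r :+ q) := q) refl r q ⟩
  q              ∎
  where open ℚP.≤-Reasoning

/-distribʳ-+ : ∀ (i j : ℤ) d .{{_ : NonZero d}} → (i ℤ.+ j) / d ≡ i / d + j / d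
/-distribʳ-+ i j d@(ℕ.suc d-1) = ℚP.toℚᵘ-injective (begin-equality
  toℚᵘ ((i ℤ.+ j) / d)              ≃⟨ ℚP.toℚᵘ-fromℚᵘ (ℚᵘ.mkℚᵘ (i ℤ.+ j) d-1) ⟩
  ℚᵘ.mkℚᵘ (i ℤ.+ j) d-1             ≃⟨ ℚᵘ.*≡* (sameDenominator (+ d)) ⟩
  ℚᵘ.mkℚᵘ i d-1 ℚᵘ.+ ℚᵘ.mkℚᵘ j d-1  ≃⟨ ℚᵘP.+-cong (ℚP.toℚᵘ-fromℚᵘ (ℚᵘ.mkℚᵘ i d-1))
                                                   (ℚP.toℚᵘ-fromℚᵘ (ℚᵘ.mkℚᵘ j d-1)) ⟨
  toℚᵘ (i / d) ℚᵘ.+ toℚᵘ (j / d)    ≃⟨ ℚP.toℚᵘ-homo-+ (i / d) (j / d) ⟨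
  toℚᵘ (i / d + j / d)              ∎)
  where
  open ℚᵘP.≤-Reasoning
  open ℤSolver.+-*-Solver using () renaming (solve to ℤsolve; _:+_ to _⊕_; _:*_ to _⊗_; _:=_ to _⊜_)
  sameDenominator : ∀ d → (i ℤ.+ j) ℤ.* (d ℤ.* d) ≡ (i ℤ.* d ℤ.+ j ℤ.* d) ℤ.* d
  sameDenominator = ℤsolve 3 (λ i j d → (i ⊕ j) ⊗ (d ⊗ d) ⊜ (i ⊗ d ⊕ j ⊗ d) ⊗ d) refl i j

n/n≡1 : ∀ d .{{_ : NonZero d}} → + d / d ≡ 1ℚ
n/n≡1 d@(ℕ.suc d-1) = ℚP.toℚᵘ-injective
  (ℚᵘP.≃-trans (ℚP.toℚᵘ-fromℚᵘ (ℚᵘ.mkℚᵘ (+ d) d-1)) (ℚᵘ.*≡* (ℤP.*-comm (+ d) (+ 1))))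

0≤1/n : ∀ d .{{_ : NonZero d}} → 0ℚ ≤ + 1 / d
0≤1/n d = ℚP.<⇒≤ (ℚP.positive⁻¹ (+ 1 / d) {{ℚP.normalize-pos 1 d}})

inGrid-+ : ∀ γ .{{_ : NonZero γ}} {p q} → InGrid γ p → InGrid γ q → InGrid γ (p + q)
inGrid-+ γ (i , refl) (j , refl) = i ℤ.+ j , sym (/-distribʳ-+ i j γ)

Balanced : ℚ → ℚ → Set
Balanced δ q = δ < q × q < 1ℚ - δ

balanced-shift : ∀ {δ q d} → Balanced δ q → - δ ≤ d → d ≤ δ → 0ℚ ≤ q + d × q + d ≤ 1ℚ
balanced-shift {δ} {q} {d} (δ<q , q<1-δ) -δ≤d d≤δ =
  (begin
    0ℚ            ≡⟨ ℚP.+-inverseʳ δ ⟨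
    δ - δ         ≤⟨ ℚP.+-mono-≤ (ℚP.<⇒≤ δ<q) -δ≤d ⟩
    q + d         ∎) ,
  (begin
    q + d         ≤⟨ ℚP.+-mono-≤ (ℚP.<⇒≤ q<1-δ) d≤δ ⟩
    (1ℚ - δ) + δ  ≡⟨ solve 1 (λ δ → (con 1ℚ :- δ) :+ δ := con 1ℚ) refl δ ⟩
    1ℚ            ∎)
  where open ℚP.≤-Reasoning

-- Opaque so that type checking never unfolds the rational comparisons inside adjacency.
opaque
  balanced? : ∀ δ q → Dec (Balanced δ q)
  balanced? δ q = (δ <? q) ×-dec (q <? 1ℚ - δ)

balancedGraph : ∀ {n} → ℚ → Graph n → Orientation n → Graph n
balancedGraph δ G X = record
  { adj    = λ u v → adj G u v ∧ does (balanced? δ (X u v) ×-dec balanced? δ (X v u))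
  ; sym    = λ u v → cong₂ _∧_ (Graph.sym G u v) (BoolP.∧-comm (does (balanced? δ (X u v))) _)
  ; irrefl = λ v → cong (_∧ _) (irrefl G v)
  }

balancedGraph-cong : ∀ {n} δ (G : Graph n) {X Y : Orientation n} u v → X u v ≡ Y u v → X v u ≡ Y v u →
                     adj (balancedGraph δ G X) u v ≡ adj (balancedGraph δ G Y) u v
balancedGraph-cong δ G u v = cong₂ (λ p q → adj G u v ∧ does (balanced? δ p ×-dec balanced? δ q))

module _ {n} (δ : ℚ) (G : Graph n) (X : Orientation n) where

  balancedGraph-⊆ : balancedGraph δ G X ⊆ᴳ G
  balancedGraph-⊆ u v = BoolP.∧-conicalˡ _ _

  balancedGraph-balanced : ∀ u v → adj (balancedGraph δ G X) u v ≡ true →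
                           Balanced δ (X u v) × Balanced δ (X v u)
  balancedGraph-balanced u v e =
    witness (balanced? δ (X u v) ×-dec balanced? δ (X v u)) (BoolP.∧-conicalʳ (adj G u v) _ e)
    where
    witness : ∀ {A : Set} (a? : Dec A) → does a? ≡ true → A
    witness (yes a) _ = a

  balancedGraph-intro : ∀ u v → adj G u v ≡ true → Balanced δ (X u v) → Balanced δ (X v u) →
                        adj (balancedGraph δ G X) u v ≡ true
  balancedGraph-intro u v uv∈G uv vu rewrite uv∈G =
    dec-true (balanced? δ (X u v) ×-dec balanced? δ (X v u)) (uv , vu)

  balancedGraph-isRefinement : ∀ {μ} → 0ℚ ≤ μ → IsRefinement δ μ G X (balancedGraph δ G X)
  balancedGraph-isRefinement {μ} 0≤μ =
    balancedGraph-⊆ ,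
    (λ u v uv∈G δ<uv uv<1-δ δ<vu vu<1-δ → balancedGraph-intro u v uv∈G (δ<uv , uv<1-δ) (δ<vu , vu<1-δ)) ,
    λ u v uv∈H → let ((δ<uv , uv<1-δ) , (δ<vu , vu<1-δ)) = balancedGraph-balanced u v uv∈H
                 in above δ<uv , below uv<1-δ , above δ<vu , below vu<1-δ
    where
    open ℚP.≤-Reasoning
    above : ∀ {q} → δ < q → δ - μ ≤ q
    above {q} δ<q = begin
      δ - μ    ≤⟨ ℚP.+-mono-≤ (ℚP.<⇒≤ δ<q) (ℚP.neg-antimono-≤ 0≤μ) ⟩
      q - 0ℚ   ≡⟨ +-identityʳ q ⟩
      q        ∎
    below : ∀ {q} → q < 1ℚ - δ → q ≤ (1ℚ - δ) + μ
    below {q} q<1-δ = begin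
      q              ≡⟨ +-identityʳ q ⟨
      q + 0ℚ         ≤⟨ ℚP.+-mono-≤ (ℚP.<⇒≤ q<1-δ) 0≤μ ⟩
      (1ℚ - δ) + μ   ∎

load-shift : ∀ {n} (G : Graph n) (X D : Orientation n) → (∀ u v → adj G u v ≡ false → D u v ≡ 0ℚ) →
             ∀ v → load G (λ u w → X u w + D u w) v ≡ load G X v + ∑[ u < n ] D v u
load-shift {n} G X D D-off v = begin
  load G (λ u w → X u w + D u w) v
    ≡⟨ sumFin≡∑ n _ ⟩
  ∑[ u < n ] (if adj G v u then X v u + D v u else 0ℚ)
    ≡⟨ sum-cong-≗ term ⟩
  ∑[ u < n ] ((if adj G v u then X v u else 0ℚ) + D v u)
    ≡⟨ ∑-distrib-+ (λ u → if adj G v u then X v u else 0ℚ) (D v) ⟩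
  ∑[ u < n ] (if adj G v u then X v u else 0ℚ) + ∑[ u < n ] D v u
    ≡⟨ cong (_+ ∑[ u < n ] D v u) (sumFin≡∑ n _) ⟨
  load G X v + ∑[ u < n ] D v u ∎
  where
  open ≡-Reasoning
  term : ∀ u → (if adj G v u then X v u + D v u else 0ℚ) ≡ (if adj G v u then X v u else 0ℚ) + D v u
  term u with adj G v u in e
  ... | true  = refl
  ... | false = sym (trans (cong (_+_ 0ℚ) (D-off v u e)) (ℚP.+-identityˡ 0ℚ))

module Rotation {n} (γ : ℕ) .{{_ : NonZero γ}} (δ α : ℚ) (G : Graph n) (1/γ<δ : + 1 / γ < δ) where

  1/γ : ℚ
  1/γ = + 1 / γ

  Bal : Orientation n → Graph n
  Bal = balancedGraph δ G

  IsOrientation : Orientation n → Set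
  IsOrientation = IsGammaOrientation γ α G

  1/γ≤δ : 1/γ ≤ δ
  1/γ≤δ = ℚP.<⇒≤ 1/γ<δ

  -δ≤-1/γ : - δ ≤ - 1/γ
  -δ≤-1/γ = ℚP.neg-antimono-≤ 1/γ≤δ

  -1/γ≤1/γ : - 1/γ ≤ 1/γ
  -1/γ≤1/γ = ℚP.≤-trans (ℚP.neg-antimono-≤ (0≤1/n γ)) (0≤1/n γ)

  ±1/γ-bounded : ∀ {d} → d ≡ 1/γ ⊎ d ≡ - 1/γ → - δ ≤ d × d ≤ δ
  ±1/γ-bounded (inj₁ refl) = ℚP.≤-trans -δ≤-1/γ -1/γ≤1/γ , 1/γ≤δ
  ±1/γ-bounded (inj₂ refl) = -δ≤-1/γ , ℚP.≤-trans -1/γ≤1/γ 1/γ≤δ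

  ±1/γ-inGrid : ∀ {d} → d ≡ 1/γ ⊎ d ≡ - 1/γ → InGrid γ d
  ±1/γ-inGrid (inj₁ refl) = + 1 , refl
  ±1/γ-inGrid (inj₂ refl) = ℤ.-[1+ 0 ] , refl

  balanced⇒<1 : ∀ {q} → Balanced δ q → q < 1ℚ
  balanced⇒<1 (_ , q<1-δ) =
    ℚP.<-trans q<1-δ (ℚP.+-monoʳ-< 1ℚ (ℚP.neg-antimono-< (ℚP.≤-<-trans (0≤1/n γ) 1/γ<δ)))

  module _ {k} (f : Fin (3 ℕ.+ k) → Fin n) (f-injective : Injective _≡_ _≡_ f) where
    open Circulation f f-injective

    shift : Fin n → Fin n → ℚ
    shift u v = 1/γ * circulation u v

    rotate : Orientation n → Orientation n
    rotate X u v = X u v + shift u v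

    ArcsIn : Graph n → Set
    ArcsIn H = ∀ i → adj H (f (cyclePred i)) (f i) ≡ true

    arcIn? : ∀ H i → Dec (adj H (f (cyclePred i)) (f i) ≡ true)
    arcIn? H i = adj H (f (cyclePred i)) (f i) BoolP.≟ true

    a₀ b₀ : Fin n
    a₀ = f (cyclePred zero)
    b₀ = f zero

    shift-skew : ∀ u v → shift v u ≡ - shift u v
    shift-skew u v = trans (cong (_*_ 1/γ) (circulation-skew u v)) (sym (ℚP.neg-distribʳ-* 1/γ (circulation u v)))

    ∑-shift : ∀ v → ∑[ u < n ] shift v u ≡ 0ℚ
    ∑-shift v = begin
      ∑[ u < n ] (1/γ * circulation v u)   ≡⟨ *-distribˡ-sum 1/γ (circulation v) ⟨
      1/γ * ∑[ u < n ] circulation v u     ≡⟨ cong (_*_ 1/γ) (∑-circulation v) ⟩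
      1/γ * 0ℚ                             ≡⟨ *-zeroʳ 1/γ ⟩
      0ℚ                                   ∎
      where open ≡-Reasoning

    rotate-unshifted : ∀ X u v → shift u v ≡ 0ℚ → rotate X u v ≡ X u v
    rotate-unshifted X u v s≡0 = trans (cong (_+_ (X u v)) s≡0) (+-identityʳ (X u v))

    rotate-sum : ∀ X u v → rotate X u v + rotate X v u ≡ X u v + X v u
    rotate-sum X u v = trans (cong (λ t → (X u v + shift u v) + (X v u + t)) (shift-skew u v))
      (solve 3 (λ x y s → (x :+ s) :+ (y :+ (:- s)) := x :+ y) refl (X u v) (X v u) (shift u v))

    rotate-firstArc : ∀ X → rotate X a₀ b₀ ≡ X a₀ b₀ + 1/γ
    rotate-firstArc X = cong (_+_ (X a₀ b₀))
      (trans (cong (_*_ 1/γ) (circulation-arc (zero , refl , refl))) (*-identityʳ 1/γ))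

    module _ (X : Orientation n) (arcs : ArcsIn (Bal X)) where

      shift-cases : ∀ u v →
        shift u v ≡ 0ℚ ⊎ (adj (Bal X) u v ≡ true × (shift u v ≡ 1/γ ⊎ shift u v ≡ - 1/γ))
      shift-cases u v with circulation-cases u v
      ... | inj₁ F≡0 = inj₁ (trans (cong (_*_ 1/γ) F≡0) (*-zeroʳ 1/γ))
      ... | inj₂ (inj₁ ((i , refl , refl) , F≡1)) =
        inj₂ (arcs i , inj₁ (trans (cong (_*_ 1/γ) F≡1) (*-identityʳ 1/γ)))
      ... | inj₂ (inj₂ ((i , refl , refl) , F≡-1)) =
        inj₂ (trans (Graph.sym (Bal X) u v) (arcs i) ,
              inj₂ (trans (cong (_*_ 1/γ) F≡-1)
                          (trans (sym (ℚP.neg-distribʳ-* 1/γ 1ℚ)) (cong -_ (*-identityʳ 1/γ)))))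

      shift-off : ∀ u v → adj G u v ≡ false → shift u v ≡ 0ℚ
      shift-off u v uv∉G with shift-cases u v
      ... | inj₁ s≡0 = s≡0
      ... | inj₂ (uv∈B , _) = contradiction (trans (sym uv∉G) (balancedGraph-⊆ δ G X u v uv∈B)) λ ()

      rotate-⊆ : Bal (rotate X) ⊆ᴳ Bal X
      rotate-⊆ u v uv∈B′ with shift-cases u v
      ... | inj₂ (uv∈B , _) = uv∈B
      ... | inj₁ s≡0 = trans (sym (balancedGraph-cong δ G {rotate X} {X} u v
                                     (rotate-unshifted X u v s≡0)
                                     (rotate-unshifted X v u (trans (shift-skew u v) (cong -_ s≡0)))))
                             uv∈B′

      rotate-∈[0,1] : ∀ u v → 0ℚ ≤ X u v → X u v ≤ 1ℚ → 0ℚ ≤ rotate X u v × rotate X u v ≤ 1ℚ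
      rotate-∈[0,1] u v 0≤x x≤1 with shift-cases u v
      ... | inj₁ s≡0 = subst (λ y → 0ℚ ≤ y × y ≤ 1ℚ) (sym (rotate-unshifted X u v s≡0)) (0≤x , x≤1)
      ... | inj₂ (uv∈B , ±1/γ) = let (-δ≤s , s≤δ) = ±1/γ-bounded ±1/γ in
        balanced-shift (proj₁ (balancedGraph-balanced δ G X u v uv∈B)) -δ≤s s≤δ

      rotate-inGrid : ∀ u v → InGrid γ (X u v) → InGrid γ (rotate X u v)
      rotate-inGrid u v x∈grid with shift-cases u v
      ... | inj₁ s≡0 = subst (InGrid γ) (sym (rotate-unshifted X u v s≡0)) x∈grid
      ... | inj₂ (_ , ±1/γ) = inGrid-+ γ x∈grid (±1/γ-inGrid ±1/γ)

      rotate-load : ∀ v → load G (rotate X) v ≡ load G X v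
      rotate-load v = trans (load-shift G X shift shift-off v)
                            (trans (cong (_+_ (load G X v)) (∑-shift v)) (+-identityʳ (load G X v)))

      rotate-isOrientation : IsOrientation X → IsOrientation (rotate X)
      rotate-isOrientation ((shares , load≤α) , grid) =
        ((λ u v uv∈G → let (0≤x , x≤1 , x+x′≡1) = shares u v uv∈G
                           (0≤y , y≤1) = rotate-∈[0,1] u v 0≤x x≤1
                       in 0≤y , y≤1 , trans (rotate-sum X u v) x+x′≡1) ,
         (λ v → subst (_≤ α) (sym (rotate-load v)) (load≤α v))) ,
        (λ u v uv∈G → rotate-inGrid u v (grid u v uv∈G))

    Shrinks : Orientation n → Set
    Shrinks X = Σ (Orientation n) λ Y → IsOrientation Y × edgeCount (Bal Y) ℕ.< edgeCount (Bal X)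

    -- Each rotation adds 1/γ to the share on the first arc, which stays below 1 while the
    -- cycle is balanced; so the bound below limits the rotations to r more.
    rotate-until-drop : ∀ r X → IsOrientation X → ArcsIn (Bal X) → 1ℚ ≤ X a₀ b₀ + + r / γ → Shrinks X
    rotate-until-drop ℕ.zero X _ arcs 1≤x+0 =
      contradiction (ℚP.≤-<-trans 1≤x+0 x+0<1) (ℚP.<-irrefl refl)
      where
      open ℚP.≤-Reasoning
      x+0<1 : X a₀ b₀ + + 0 / γ < 1ℚ
      x+0<1 = begin-strict
        X a₀ b₀ + + 0 / γ   ≡⟨ cong (_+_ (X a₀ b₀)) (ℚP.0/n≡0 γ) ⟩
        X a₀ b₀ + 0ℚ        ≡⟨ +-identityʳ (X a₀ b₀) ⟩
        X a₀ b₀             <⟨ balanced⇒<1 (proj₁ (balancedGraph-balanced δ G X a₀ b₀ (arcs zero))) ⟩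
        1ℚ                  ∎
    rotate-until-drop (ℕ.suc r) X isOr arcs 1≤x+r+1 = continue (all? (arcIn? (Bal (rotate X))))
      where
      open ℚP.≤-Reasoning
      1≤x′+r : 1ℚ ≤ rotate X a₀ b₀ + + r / γ
      1≤x′+r = begin
        1ℚ                          ≤⟨ 1≤x+r+1 ⟩
        X a₀ b₀ + + ℕ.suc r / γ     ≡⟨ cong (_+_ (X a₀ b₀)) (/-distribʳ-+ (+ 1) (+ r) γ) ⟩
        X a₀ b₀ + (1/γ + + r / γ)   ≡⟨ ℚP.+-assoc (X a₀ b₀) 1/γ (+ r / γ) ⟨
        X a₀ b₀ + 1/γ + + r / γ     ≡⟨ cong (_+ + r / γ) (rotate-firstArc X) ⟨
        rotate X a₀ b₀ + + r / γ    ∎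
      continue : Dec (ArcsIn (Bal (rotate X))) → Shrinks X
      continue (yes arcs′) =
        let (Y , isOrY , Y<) = rotate-until-drop r (rotate X) (rotate-isOrientation X arcs isOr) arcs′ 1≤x′+r
        in Y , isOrY , ℕP.<-≤-trans Y< (edgeCount-mono (Bal (rotate X)) (Bal X) (rotate-⊆ X arcs))
      continue (no ¬arcs′) =
        let (i , dropped) = ¬∀⟶∃¬ _ _ (arcIn? (Bal (rotate X))) ¬arcs′
        in rotate X , rotate-isOrientation X arcs isOr ,
           edgeCount-< (Bal (rotate X)) (Bal X) (rotate-⊆ X arcs) (f (cyclePred i)) (f i)
                       (BoolP.¬-not dropped) (arcs i)

    rotate-shrinks : ∀ X → IsOrientation X → ArcsIn (Bal X) → Shrinks X
    rotate-shrinks X isOr arcs = rotate-until-drop γ X isOr arcs (begin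
      1ℚ                  ≡⟨ ℚP.+-identityˡ 1ℚ ⟨
      0ℚ + 1ℚ             ≤⟨ ℚP.+-monoˡ-≤ 1ℚ 0≤x₀ ⟩
      X a₀ b₀ + 1ℚ        ≡⟨ cong (_+_ (X a₀ b₀)) (n/n≡1 γ) ⟨
      X a₀ b₀ + + γ / γ   ∎)
      where
      open ℚP.≤-Reasoning
      0≤x₀ : 0ℚ ≤ X a₀ b₀
      0≤x₀ = proj₁ (proj₁ (proj₁ isOr) a₀ b₀ (balancedGraph-⊆ δ G X a₀ b₀ (arcs zero)))

  balancedForest : ∀ X → IsOrientation X → Acc ℕ._<_ (edgeCount (Bal X)) →
                   Σ (Orientation n) λ Y → IsOrientation Y × IsForest (Bal Y)
  balancedForest X isOr (acc smaller) with hasCycle? (Bal X)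
  ... | no acyclic = X , isOr , acyclic
  ... | yes (k , f , cycle) =
    let (Y , isOrY , Y<) = rotate-shrinks f (proj₁ cycle) X isOr (isCycle⇒arcs (Bal X) cycle)
    in balancedForest Y isOrY (smaller Y<)

mainTheorem7 : (γ : ℕ) .{{_ : NonZero γ}} (δ μ α : ℚ) →
    δ < 1ℚ → (+ 1 / γ) + μ < δ → (+ 2 / γ) ≤ (+ 1 / γ) + μ → 0ℚ < (+ 2 / γ) →
    0ℚ < α →
    (n : ℕ) (G : Graph n) (X : Orientation n) → IsGammaOrientation γ α G X →
    (H : Graph n) → IsRefinement δ μ G X H →
    Σ (Orientation n) λ X′ → Σ (Graph n) λ H′ →
      IsGammaOrientation γ α G X′ × IsRefinement δ μ G X′ H′ × IsForest H′
mainTheorem7 γ δ μ α _ 1/γ+μ<δ 2/γ≤1/γ+μ _ _ n G X isOr _ _ =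
  let (Y , isOrY , forest) = Rotation.balancedForest γ δ α G 1/γ<δ X isOr (<-wellFounded _)
  in Y , balancedGraph δ G Y , isOrY , balancedGraph-isRefinement δ G Y 0≤μ , forest
  where
  open ℚP.≤-Reasoning
  1/γ≤μ : + 1 / γ ≤ μ
  1/γ≤μ = +-cancelˡ-≤ (+ 1 / γ) (subst (_≤ + 1 / γ + μ) (/-distribʳ-+ (+ 1) (+ 1) γ) 2/γ≤1/γ+μ)
  0≤μ : 0ℚ ≤ μ
  0≤μ = ℚP.≤-trans (0≤1/n γ) 1/γ≤μ
  1/γ<δ : + 1 / γ < δ
  1/γ<δ = begin-strict
    + 1 / γ         ≡⟨ +-identityʳ (+ 1 / γ) ⟨
    + 1 / γ + 0ℚ    ≤⟨ ℚP.+-monoʳ-≤ (+ 1 / γ) 0≤μ ⟩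
    + 1 / γ + μ     <⟨ 1/γ+μ<δ ⟩
    δ               ∎
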